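{- Let $G$ be a connected graph of order $n_G$ and let $H$ be a connected subgraph of $G$ of order $n_H\ge 2$. Then for each integer $k$ with $3\le k\le n_H$ we have $px_k(G)\le px_k(H)+n_G-n_H$, and for each integer $k$ with $n_H\le k\le n_G$ and $k\ge 3$ we have $px_k(G)\le px_{n_H}(H)+n_G-n_H$.
   Context: All graphs are finite, simple and undirected. In an edge-colored graph (adjacent edges may receive the same color), a tree is proper if no two adjacent edges of it receive the same color. For a connected graph $G$ of order $n$, an integer $2\le k\le n$ and $S\subseteq V(G)$, an $S$-tree is a tree in $G$ containing all vertices of $S$. An edge-coloring of $G$ is a $k$-proper coloring if for every $k$-subset $S$ of $V(G)$ there is a proper $S$-tree in $G$. The $k$-proper index $px_k(G)$ is the minimum number of colors in a $k$-proper coloring of $G$; $px_2(G)$ is the proper connection number. -}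

module Defs where

open import Data.Nat using (ℕ; zero; suc; _≤_; _+_; _∸_)
open import Data.Fin using (Fin)
open import Data.Fin.Subset using (Subset; _∈_; ∣_∣)
open import Data.Bool using (Bool; true; false)
open import Data.List using (List; []; _∷_; length; last; head)
open import Data.List.Relation.Unary.Unique.Propositional using (Unique)
open import Data.Maybe using (just)
open import Data.Product using (Σ; _×_; ∃)
open import Data.Empty using (⊥)
open import Function using (Injective)
open import Relation.Binary.PropositionalEquality using (_≡_; _≢_)
open import Relation.Nullary using (¬_)

record Graph (n : ℕ) : Set where
  field
    adj   : Fin n → Fin n → Bool
    sym   : ∀ u v → adj u v ≡ adj v u
    irrefl : ∀ u → adj u u ≡ false
open Graph public

EdgeRel : ℕ → Set
EdgeRel n = Fin n → Fin n → Bool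

data Walk {n : ℕ} (E : EdgeRel n) : Fin n → Fin n → Set where
  here : ∀ {u} → Walk E u u
  step : ∀ {u v w} → E u v ≡ true → Walk E v w → Walk E u w

Connected : ∀ {n} → Graph n → Set
Connected G = ∀ u v → Walk (adj G) u v

Subgraph : ∀ {nH nG} → Graph nH → Graph nG → Set
Subgraph {nH} {nG} H G =
  Σ (Fin nH → Fin nG) λ f → Injective _≡_ _≡_ f ×
    (∀ u v → adj H u v ≡ true → adj G (f u) (f v) ≡ true)

data Chain {n : ℕ} (E : EdgeRel n) : List (Fin n) → Set where
  nil  : Chain E []
  one  : ∀ {u} → Chain E (u ∷ [])
  cons : ∀ {u v vs} → E u v ≡ true → Chain E (v ∷ vs) → Chain E (u ∷ v ∷ vs)

record Cycle {n : ℕ} (E : EdgeRel n) : Set where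
  field
    verts  : List (Fin n)
    len≥3  : 3 ≤ length verts
    distinct : Unique verts
    chain  : Chain E verts
    first last' : Fin n
    isHead : head verts ≡ just first
    isLast : last verts ≡ just last'
    closes : E last' first ≡ true

record Tree {n : ℕ} (G : Graph n) : Set where
  field
    V : Subset n
    T : EdgeRel n
    T-sym : ∀ u v → T u v ≡ T v u
    T⊆G : ∀ u v → T u v ≡ true → adj G u v ≡ true
    T-ends : ∀ u v → T u v ≡ true → (u ∈ V) × (v ∈ V)
    connected : ∀ u v → u ∈ V → v ∈ V → Walk T u v
    acyclic : ¬ Cycle T
open Tree public

-- An edge-coloring of G with (at most) m colors, the colors being Fin m.
-- (Only the values on edges of G matter.)
record Coloring {n : ℕ} (G : Graph n) (m : ℕ) : Set where
  field
    col : Fin n → Fin n → Fin m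
    col-sym : ∀ u v → col u v ≡ col v u
open Coloring public

ProperTree : ∀ {n m} {G : Graph n} → Coloring G m → Tree G → Set
ProperTree c t = ∀ u v w → T t u v ≡ true → T t v w ≡ true → u ≢ w →
  col c u v ≢ col c v w

IsSTree : ∀ {n} {G : Graph n} → Subset n → Tree G → Set
IsSTree S t = ∀ v → v ∈ S → v ∈ V t

KProper : ∀ {n m} (G : Graph n) (k : ℕ) → Coloring G m → Set
KProper {n} G k c = ∀ (S : Subset n) → ∣ S ∣ ≡ k →
  Σ (Tree G) λ t → IsSTree S t × ProperTree c t

HasKProperColoring : ∀ {n} → Graph n → ℕ → ℕ → Set
HasKProperColoring G k m = Σ (Coloring _ m) λ c → KProper G k c

IsPx : ∀ {n} → Graph n → ℕ → ℕ → Set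
IsPx G k p = HasKProperColoring G k p × (∀ m → HasKProperColoring G k m → p ≤ m)

module Submission where

-- Transport a colouring of H to G along the embedding f : H → G.
-- Every set of at most k vertices of the image f(H) is then spanned by a
-- proper tree inside f(H) (the image of a proper tree of H).  Then add the
-- remaining vertices of G one at a time: a vertex a outside the current set W
-- with a neighbour u in W is attached as a pendant vertex, and the edge au
-- gets a brand-new colour.  A set S ∋ a is spanned by attaching a to a proper
-- tree spanning (S ∩ W) ∪ {u}; the fresh colour keeps the tree proper, and a
-- pendant vertex creates no cycle.  After n_G - n_H steps W = V(G).

open import Defs
open import Data.Bool using (Bool; true; false; if_then_else_)
open import Data.Bool.Properties using () renaming (_≟_ to _≟ᵇ_)
open import Data.Empty using (⊥; ⊥-elim)
open import Data.Fin using (Fin; zero; suc; fromℕ; inject₁; inject≤; _≟_)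
open import Data.Fin.Properties
  using (any?; suc-injective; fromℕ≢inject₁; inject₁-injective; inject≤-injective)
open import Data.Fin.Subset
  using (Subset; ⁅_⁆; _∪_; _∩_; _-_; ∣_∣; _⊆_; ⊤; _∉_) renaming (_∈_ to _∈ₛ_)
open import Data.Fin.Subset.Properties
  using ( _∈?_; ∈⊤; ∣⊤∣≡n; ∣p∣≤n; ∣p∣≡n⇒p≡⊤; p⊆q⇒∣p∣≤∣q∣; p⊂q⇒∣p∣<∣q∣; ∪-identityʳ
        ; x∈⁅x⁆; x∈⁅y⁆⇒x≡y; x∈p∪q⁺; x∈p∪q⁻; p⊆p∪q; x∈p∧x≢y⇒x∈p-y
        ; x∈p⇒∣p-x∣<∣p∣; ∣p─q∣≤∣p∣; p∩q⊆p; x∈p∩q⁺; x∈p∩q⁻)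
open import Data.List using (List; []; _∷_; _++_; _∷ʳ_; length; head; last; map; initLast; _∷ʳ′_)
open import Data.List.Properties using (++-assoc; length-map; head-map; last-map)
open import Data.List.Membership.Propositional using () renaming (_∈_ to _∈ₗ_; _∉_ to _∉ₗ_)
open import Data.List.Membership.Propositional.Properties using (∈-∃++; ∈-++⁺ˡ; ∈-++⁺ʳ)
open import Data.List.Relation.Unary.All as All using (All; []; _∷_)
open import Data.List.Relation.Unary.All.Properties using (¬Any⇒All¬) renaming (map⁺ to All-map⁺)
open import Data.List.Relation.Unary.AllPairs using ([]; _∷_)
open import Data.List.Relation.Unary.Any as Any using ()
open import Data.List.Relation.Unary.Unique.Propositional using (Unique)
open import Data.Maybe using (just)
import Data.Maybe as Maybe
open import Data.Maybe.Properties using (just-injective)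
open import Data.Nat using (ℕ; zero; suc; _≤_; _<_; _+_; _∸_; z≤n; s≤s; _<?_)
import Data.Nat.Properties as ℕ
open import Data.Product using (Σ; ∃; _×_; _,_; proj₁; proj₂)
open import Data.Sum using (_⊎_; inj₁; inj₂)
open import Data.Vec using (_∷_; tabulate)
open import Data.Vec.Properties using (lookup∘tabulate; []=⇒lookup; lookup⇒[]=)
open import Function using (_∘_; id; Injective; mk⇔)
open import Relation.Nullary using (Dec; yes; no; does; ¬_; ¬?; _×-dec_; _⊎-dec_)
open import Relation.Nullary.Decidable using (dec-true; dec-false; does-⇔; decidable-stable)
open import Relation.Unary using (Decidable)
open import Relation.Binary.PropositionalEquality
  using (_≡_; _≢_; refl; trans; cong; cong₂; subst; subst₂) renaming (sym to ≡-sym)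

witness : ∀ {A : Set} (d : Dec A) → does d ≡ true → A
witness (yes a) _ = a
witness (no _) ()

subsetOf : ∀ {n} {P : Fin n → Set} → Decidable P → Subset n
subsetOf P? = tabulate (does ∘ P?)

subsetOf⁺ : ∀ {n} {P : Fin n → Set} (P? : Decidable P) {x} → P x → x ∈ₛ subsetOf P?
subsetOf⁺ P? {x} p = lookup⇒[]= x _ (trans (lookup∘tabulate _ x) (dec-true (P? x) p))

subsetOf⁻ : ∀ {n} {P : Fin n → Set} (P? : Decidable P) {x} → x ∈ₛ subsetOf P? → P x
subsetOf⁻ P? {x} x∈ = witness (P? x) (trans (≡-sym (lookup∘tabulate _ x)) ([]=⇒lookup x∈))

preimage : ∀ {m n} → (Fin m → Fin n) → Subset n → Subset m
preimage f S = subsetOf (λ i → f i ∈? S)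

∣∷∣≤ : ∀ {n m} b (p : Subset m) {S : Subset n} x →
  (b ≡ true → x ∈ₛ S) → ∣ p ∣ ≤ ∣ S - x ∣ → ∣ b ∷ p ∣ ≤ ∣ S ∣
∣∷∣≤ true  p x x∈S le = ℕ.≤-trans (s≤s le) (x∈p⇒∣p-x∣<∣p∣ (x∈S refl))
∣∷∣≤ false p {S} x _ le = ℕ.≤-trans le (∣p─q∣≤∣p∣ S ⁅ x ⁆)

∣preimage∣≤ : ∀ {m n} (f : Fin m → Fin n) → Injective _≡_ _≡_ f →
  ∀ S → ∣ preimage f S ∣ ≤ ∣ S ∣
∣preimage∣≤ {zero}  f inj S = z≤n
∣preimage∣≤ {suc m} f inj S =
  ∣∷∣≤ (does (f zero ∈? S)) (preimage (f ∘ suc) S) (f zero) (witness (f zero ∈? S))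
    (ℕ.≤-trans (p⊆q⇒∣p∣≤∣q∣ avoid-f0)
      (∣preimage∣≤ (f ∘ suc) (suc-injective ∘ inj) (S - f zero)))
  where
  -- f (suc i) differs from f zero, so it survives the removal of f zero.
  avoid-f0 : preimage (f ∘ suc) S ⊆ preimage (f ∘ suc) (S - f zero)
  avoid-f0 {i} i∈ = subsetOf⁺ (λ j → f (suc j) ∈? (S - f zero))
    (x∈p∧x≢y⇒x∈p-y (subsetOf⁻ (λ j → f (suc j) ∈? S) i∈) (λ eq → suc≢zero (inj eq)))
    where
    suc≢zero : suc i ≢ zero
    suc≢zero ()

outside : ∀ {n} (p : Subset n) → ∣ p ∣ < n → ∃ λ x → x ∉ p
outside {n} p ∣p∣<n with any? (λ x → ¬? (x ∈? p))
... | yes found = found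
... | no  none  = ⊥-elim (ℕ.<⇒≱ ∣p∣<n (subst (_≤ ∣ p ∣) (∣⊤∣≡n n)
                    (p⊆q⇒∣p∣≤∣q∣ {p = ⊤} λ {x} _ →
                      decidable-stable (x ∈? p) (λ x∉p → none (x , x∉p)))))

∣p∪⁅x⁆∣≤ : ∀ {n} (p : Subset n) x → ∣ p ∪ ⁅ x ⁆ ∣ ≤ suc ∣ p ∣
∣p∪⁅x⁆∣≤ (true  ∷ p) zero    = s≤s (ℕ.m≤n⇒m≤1+n (ℕ.≤-reflexive (cong ∣_∣ (∪-identityʳ p))))
∣p∪⁅x⁆∣≤ (false ∷ p) zero    = s≤s (ℕ.≤-reflexive (cong ∣_∣ (∪-identityʳ p)))
∣p∪⁅x⁆∣≤ (true  ∷ p) (suc x) = s≤s (∣p∪⁅x⁆∣≤ p x)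
∣p∪⁅x⁆∣≤ (false ∷ p) (suc x) = ∣p∪⁅x⁆∣≤ p x

∣p∪⁅x⁆∣≡ : ∀ {n} (p : Subset n) {x} → x ∉ p → ∣ p ∪ ⁅ x ⁆ ∣ ≡ suc ∣ p ∣
∣p∪⁅x⁆∣≡ p {x} x∉p = ℕ.≤-antisym (∣p∪⁅x⁆∣≤ p x)
  (p⊂q⇒∣p∣<∣q∣ (p⊆p∪q ⁅ x ⁆ , x , x∈p∪q⁺ (inj₂ (x∈⁅x⁆ x)) , x∉p))

-- Trading one unit of budget for one new element keeps |S| + budget fixed.
∣p∪⁅x⁆∣+d : ∀ {n} (p : Subset n) {x} d → x ∉ p → ∣ p ∣ + suc d ≡ ∣ p ∪ ⁅ x ⁆ ∣ + d
∣p∪⁅x⁆∣+d p d x∉p = trans (ℕ.+-suc _ d) (cong (_+ d) (≡-sym (∣p∪⁅x⁆∣≡ p x∉p)))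

enlarge : ∀ {n} d (S : Subset n) → ∣ S ∣ + d ≤ n →
  Σ (Subset n) λ S′ → S ⊆ S′ × ∣ S′ ∣ ≡ ∣ S ∣ + d
enlarge zero S _ = S , id , ≡-sym (ℕ.+-identityʳ _)
enlarge {n} (suc d) S fits with outside S (ℕ.<-≤-trans (ℕ.m<m+n _ (s≤s z≤n)) fits)
... | x , x∉S with enlarge d (S ∪ ⁅ x ⁆) (subst (_≤ n) (∣p∪⁅x⁆∣+d S d x∉S) fits)
...   | S′ , S∪x⊆S′ , size =
  S′ , S∪x⊆S′ ∘ p⊆p∪q ⁅ x ⁆ , trans size (≡-sym (∣p∪⁅x⁆∣+d S d x∉S))

mapWalk : ∀ {n n′} {E : EdgeRel n} {E′ : EdgeRel n′} (g : Fin n → Fin n′) →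
  (∀ x y → E x y ≡ true → E′ (g x) (g y) ≡ true) →
  ∀ {x y} → Walk E x y → Walk E′ (g x) (g y)
mapWalk g hom here       = here
mapWalk g hom (step e w) = step (hom _ _ e) (mapWalk g hom w)

_++ʷ_ : ∀ {n} {E : EdgeRel n} {x y z} → Walk E x y → Walk E y z → Walk E x z
here     ++ʷ w′ = w′
step e w ++ʷ w′ = step e (w ++ʷ w′)

crossing : ∀ {n} {E : EdgeRel n} (W : Subset n) {x y} → Walk E x y → x ∉ W → y ∈ₛ W →
  Σ (Fin n) λ a → Σ (Fin n) λ b → a ∉ W × b ∈ₛ W × E a b ≡ true
crossing W here x∉W x∈W = ⊥-elim (x∉W x∈W)
crossing W (step {u = x} {v = v} e w) x∉W y∈W with v ∈? W
... | yes v∈W = x , v , x∉W , v∈W , e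
... | no  v∉W = crossing W w v∉W y∈W

headMem : ∀ {A : Set} (xs : List A) {l} → head xs ≡ just l → l ∈ₗ xs
headMem (x ∷ xs) refl = Any.here refl

lastMem : ∀ {A : Set} (xs : List A) {l} → last xs ≡ just l → l ∈ₗ xs
lastMem (x ∷ [])     refl = Any.here refl
lastMem (x ∷ y ∷ ys) eq   = Any.there (lastMem (y ∷ ys) eq)

last-∷ʳ : ∀ {A : Set} (xs : List A) {a} → last (xs ∷ʳ a) ≡ just a
last-∷ʳ []           = refl
last-∷ʳ (x ∷ [])     = refl
last-∷ʳ (x ∷ y ∷ xs) = last-∷ʳ (y ∷ xs)

unique-apart : ∀ {A : Set} (xs : List A) {ys : List A} {x y : A} →
  Unique (xs ++ ys) → x ∈ₗ xs → y ∈ₗ ys → x ≢ y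
unique-apart (z ∷ xs) (z∉ ∷ _) (Any.here refl) y∈ = All.lookup z∉ (∈-++⁺ʳ xs y∈)
unique-apart (z ∷ xs) (_ ∷ u)  (Any.there x∈)  y∈ = unique-apart xs u x∈ y∈

unique-map : ∀ {A B : Set} {P : A → Set} (g : A → B) →
  (∀ {x y} → P x → P y → g x ≡ g y → x ≡ y) →
  ∀ {xs} → All P xs → Unique xs → Unique (map g xs)
unique-map g inj []         []          = []
unique-map g inj (px ∷ pxs) (x∉ ∷ uniq) =
  All-map⁺ (All.zipWith (λ (x≢y , py) eq → x≢y (inj px py eq)) (x∉ , pxs))
    ∷ unique-map g inj pxs uniq

chain-step : ∀ {n} {E : EdgeRel n} xs {x y ys} → Chain E (xs ++ x ∷ y ∷ ys) → E x y ≡ true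
chain-step []           (cons e _) = e
chain-step (_ ∷ [])     (cons _ c) = chain-step [] c
chain-step (_ ∷ w ∷ zs) (cons _ c) = chain-step (w ∷ zs) c

-- In a chain with at least one edge, every entry is an end of an edge,
-- so it inherits any property shared by both ends of all edges.
chain-ends : ∀ {n} {E : EdgeRel n} {P : Fin n → Set} →
  (∀ x y → E x y ≡ true → P x × P y) → ∀ {vs} → Chain E vs → 2 ≤ length vs → All P vs
chain-ends ends one (s≤s ())
chain-ends ends (cons e one)          _ = proj₁ (ends _ _ e) ∷ proj₂ (ends _ _ e) ∷ []
chain-ends ends (cons e (cons e′ c)) _ = proj₁ (ends _ _ e) ∷ chain-ends ends (cons e′ c) (s≤s (s≤s z≤n))

mapChain : ∀ {n n′} {E : EdgeRel n} {E′ : EdgeRel n′} {P : Fin n → Set} (g : Fin n → Fin n′) →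
  (∀ {x y} → P x → P y → E x y ≡ true → E′ (g x) (g y) ≡ true) →
  ∀ {vs} → All P vs → Chain E vs → Chain E′ (map g vs)
mapChain g hom _                nil        = nil
mapChain g hom _                one        = one
mapChain g hom (px ∷ py ∷ pvs) (cons e c) = cons (hom px py e) (mapChain g hom (py ∷ pvs) c)

mapCycle : ∀ {n n′} {E : EdgeRel n} {E′ : EdgeRel n′} {P : Fin n → Set} (g : Fin n → Fin n′) →
  (∀ {x y} → P x → P y → g x ≡ g y → x ≡ y) →
  (∀ {x y} → P x → P y → E x y ≡ true → E′ (g x) (g y) ≡ true) →
  (c : Cycle E) → All P (Cycle.verts c) → Cycle E′
mapCycle g inj hom c all-P = record
  { verts    = map g verts
  ; len≥3    = subst (3 ≤_) (≡-sym (length-map g verts)) len≥3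
  ; distinct = unique-map g inj all-P distinct
  ; chain    = mapChain g hom all-P chain
  ; first    = g first
  ; last'    = g last'
  ; isHead   = trans (head-map {f = g} verts) (cong (Maybe.map g) isHead)
  ; isLast   = trans (last-map g verts) (cong (Maybe.map g) isLast)
  ; closes   = hom (All.lookup all-P (lastMem verts isLast))
                   (All.lookup all-P (headMem verts isHead)) closes
  }
  where open Cycle c

-- A pendant vertex a (every neighbour of a, in either direction, is u) lies
-- on no cycle: its predecessor and its successor on the cycle would be two
-- distinct vertices that are both equal to u.
pendant∉cycle : ∀ {n} {E : EdgeRel n} {a u : Fin n} →
  (∀ x → E x a ≡ true → x ≡ u) → (∀ y → E a y ≡ true → y ≡ u) →
  (c : Cycle E) → a ∉ₗ Cycle.verts c
pendant∉cycle {E = E} {a} into out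
  record { len≥3 = len ; distinct = uniq ; chain = ch ; isHead = hd ; isLast = ls ; closes = cl } a∈
  with ∈-∃++ a∈
... | xs , zs , refl = around xs zs len uniq ch hd ls cl
  where
  around : ∀ xs zs {f l} → 3 ≤ length (xs ++ a ∷ zs) → Unique (xs ++ a ∷ zs) →
    Chain E (xs ++ a ∷ zs) → head (xs ++ a ∷ zs) ≡ just f → last (xs ++ a ∷ zs) ≡ just l →
    E l f ≡ true → ⊥
  around xs zs len uniq ch hd ls cl with initLast xs
  -- a comes first: its successor y and the last vertex l are distinct.
  around .[] [] (s≤s ()) _ _ _ _ _ | []
  around .[] (y ∷ []) (s≤s (s≤s ())) _ _ _ _ _ | []
  around .[] (y ∷ w ∷ ws) _ uniq (cons e _) refl ls cl | [] =
    unique-apart (a ∷ y ∷ []) uniq (Any.there (Any.here refl)) (lastMem (w ∷ ws) ls)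
      (trans (out y e) (≡-sym (into _ cl)))
  -- a has a predecessor x and a successor y inside the list.
  around .(xs₀ ∷ʳ x) (y ∷ ys) _ uniq ch _ _ _ | xs₀ ∷ʳ′ x =
    unique-apart (xs₀ ∷ʳ x) uniq (∈-++⁺ʳ xs₀ (Any.here refl)) (Any.there (Any.here refl))
      (trans (into x (chain-step xs₀ (subst (Chain E) (++-assoc xs₀ (x ∷ []) (a ∷ y ∷ ys)) ch)))
             (≡-sym (out y (chain-step (xs₀ ∷ʳ x) ch))))
  -- a comes last: its predecessor x and the first vertex g are distinct.
  around .([] ∷ʳ x) [] (s≤s (s≤s ())) _ _ _ _ _ | [] ∷ʳ′ x
  around .((g ∷ gs) ∷ʳ x) [] {l = l} _ uniq ch refl ls cl | (g ∷ gs) ∷ʳ′ x =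
    unique-apart (g ∷ []) uniq (Any.here refl) (∈-++⁺ˡ (∈-++⁺ʳ gs (Any.here refl)))
      (trans (out g (subst (λ z → E z g ≡ true) l≡a cl))
             (≡-sym (into x (chain-step (g ∷ gs)
               (subst (Chain E) (++-assoc (g ∷ gs) (x ∷ []) (a ∷ [])) ch)))))
    where
    l≡a : l ≡ a
    l≡a = just-injective (trans (≡-sym ls) (last-∷ʳ ((g ∷ gs) ∷ʳ x)))

IsPair : ∀ {n} (a u x y : Fin n) → Set
IsPair a u x y = (x ≡ a × y ≡ u) ⊎ (x ≡ u × y ≡ a)

isPair? : ∀ {n} (a u x y : Fin n) → Dec (IsPair a u x y)
isPair? a u x y = (x ≟ a ×-dec y ≟ u) ⊎-dec (x ≟ u ×-dec y ≟ a)

IsPair-sym : ∀ {n} {a u x y : Fin n} → IsPair a u x y → IsPair a u y x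
IsPair-sym (inj₁ (x≡a , y≡u)) = inj₂ (y≡u , x≡a)
IsPair-sym (inj₂ (x≡u , y≡a)) = inj₁ (y≡a , x≡u)

isPair-sym : ∀ {n} (a u x y : Fin n) → does (isPair? a u x y) ≡ does (isPair? a u y x)
isPair-sym a u x y = does-⇔ (mk⇔ IsPair-sym IsPair-sym) (isPair? a u x y) (isPair? a u y x)

IsPair-shared : ∀ {n} {a u x y z : Fin n} → a ≢ u → IsPair a u x y → IsPair a u y z → x ≡ z
IsPair-shared a≢u (inj₁ (refl , refl)) (inj₁ (y≡a , _))    = ⊥-elim (a≢u (≡-sym y≡a))
IsPair-shared a≢u (inj₁ (refl , refl)) (inj₂ (_ , refl))   = refl
IsPair-shared a≢u (inj₂ (refl , refl)) (inj₁ (_ , refl))   = refl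
IsPair-shared a≢u (inj₂ (refl , refl)) (inj₂ (y≡u , _))    = ⊥-elim (a≢u y≡u)

addEdge : ∀ {n} → EdgeRel n → Fin n → Fin n → EdgeRel n
addEdge E a u x y = does ((E x y ≟ᵇ true) ⊎-dec isPair? a u x y)

addEdge⁻ : ∀ {n} {E : EdgeRel n} {a u x y} → addEdge E a u x y ≡ true → E x y ≡ true ⊎ IsPair a u x y
addEdge⁻ {E = E} {a} {u} {x} {y} = witness ((E x y ≟ᵇ true) ⊎-dec isPair? a u x y)

addEdge⁺ : ∀ {n} {E : EdgeRel n} {a u x y} → E x y ≡ true ⊎ IsPair a u x y → addEdge E a u x y ≡ true
addEdge⁺ {E = E} {a} {u} {x} {y} = dec-true ((E x y ≟ᵇ true) ⊎-dec isPair? a u x y)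

addEdge-sym : ∀ {n} {E : EdgeRel n} → (∀ x y → E x y ≡ E y x) →
  ∀ a u x y → addEdge E a u x y ≡ addEdge E a u y x
addEdge-sym {E = E} E-sym a u x y =
  does-⇔ (mk⇔ swap swap) ((E x y ≟ᵇ true) ⊎-dec isPair? a u x y) ((E y x ≟ᵇ true) ⊎-dec isPair? a u y x)
  where
  swap : ∀ {x y} → E x y ≡ true ⊎ IsPair a u x y → E y x ≡ true ⊎ IsPair a u y x
  swap {x} {y} (inj₁ e) = inj₁ (trans (E-sym y x) e)
  swap (inj₂ p) = inj₂ (IsPair-sym p)

recolour : ∀ {n m} {G : Graph n} → Coloring G m → Fin n → Fin n → Coloring G (suc m)
recolour {m = m} c a u = record
  { col     = λ x y → fresh (does (isPair? a u x y)) (col c x y)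
  ; col-sym = λ x y → cong₂ fresh (isPair-sym a u x y) (col-sym c x y)
  }
  where
  fresh : Bool → Fin m → Fin (suc m)
  fresh b old = if b then fromℕ m else inject₁ old

recolour-new : ∀ {n m} {G : Graph n} (c : Coloring G m) {a u x y} →
  IsPair a u x y → col (recolour c a u) x y ≡ fromℕ m
recolour-new c {a} {u} {x} {y} p rewrite dec-true (isPair? a u x y) p = refl

recolour-old : ∀ {n m} {G : Graph n} (c : Coloring G m) {a u x y} →
  ¬ IsPair a u x y → col (recolour c a u) x y ≡ inject₁ (col c x y)
recolour-old c {a} {u} {x} {y} ¬p rewrite dec-false (isPair? a u x y) ¬p = refl

recolour-distinct : ∀ {n m} {G : Graph n} (c : Coloring G m) {a u x y z} →
  ¬ IsPair a u x y → ¬ IsPair a u y z → col c x y ≢ col c y z →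
  col (recolour c a u) x y ≢ col (recolour c a u) y z
recolour-distinct c ¬xy ¬yz differ rewrite recolour-old c ¬xy | recolour-old c ¬yz =
  differ ∘ inject₁-injective

recolour-new≢old : ∀ {n m} {G : Graph n} (c : Coloring G m) {a u x y x′ y′} →
  IsPair a u x y → ¬ IsPair a u x′ y′ → col (recolour c a u) x y ≢ col (recolour c a u) x′ y′
recolour-new≢old c new ¬old same =
  fromℕ≢inject₁ (trans (≡-sym (recolour-new c new)) (trans same (recolour-old c ¬old)))

recolour-proper : ∀ {n m} {G : Graph n} (c : Coloring G m) {a u} (t : Tree G) →
  (∀ x y → T t x y ≡ true → ¬ IsPair a u x y) → ProperTree c t → ProperTree (recolour c a u) t
recolour-proper c t avoids proper x y z xy yz x≢z =
  recolour-distinct c (avoids x y xy) (avoids y z yz) (proper x y z xy yz x≢z)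

edges-avoid : ∀ {n} {G : Graph n} (t : Tree G) {a u : Fin n} → a ∉ V t →
  ∀ x y → T t x y ≡ true → ¬ IsPair a u x y
edges-avoid t a∉t x y e (inj₁ (refl , _)) = a∉t (proj₁ (T-ends t x y e))
edges-avoid t a∉t x y e (inj₂ (_ , refl)) = a∉t (proj₂ (T-ends t x y e))

module Attach {n} {G : Graph n} (t : Tree G) {a u : Fin n}
  (a∉t : a ∉ V t) (u∈t : u ∈ₛ V t) (au : adj G a u ≡ true) where

  T′ : EdgeRel n
  T′ = addEdge (T t) a u

  V′ : Subset n
  V′ = V t ∪ ⁅ a ⁆

  edge⁻ : ∀ {x y} → T′ x y ≡ true → T t x y ≡ true ⊎ IsPair a u x y
  edge⁻ {x} {y} = addEdge⁻ {E = T t} {a} {u} {x} {y}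

  edge⁺ : ∀ {x y} → T t x y ≡ true ⊎ IsPair a u x y → T′ x y ≡ true
  edge⁺ {x} {y} = addEdge⁺ {E = T t} {a} {u} {x} {y}

  a≢u : a ≢ u
  a≢u refl = a∉t u∈t

  a∈V′ : a ∈ₛ V′
  a∈V′ = x∈p∪q⁺ (inj₂ (x∈⁅x⁆ a))

  u∈V′ : u ∈ₛ V′
  u∈V′ = x∈p∪q⁺ (inj₁ u∈t)

  old-not-new : ∀ x y → T t x y ≡ true → ¬ IsPair a u x y
  old-not-new = edges-avoid t a∉t

  into-a : ∀ x → T′ x a ≡ true → x ≡ u
  into-a x e with edge⁻ e
  ... | inj₁ old               = ⊥-elim (a∉t (proj₂ (T-ends t x a old)))
  ... | inj₂ (inj₁ (_ , a≡u))  = ⊥-elim (a≢u a≡u)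
  ... | inj₂ (inj₂ (x≡u , _))  = x≡u

  out-of-a : ∀ y → T′ a y ≡ true → y ≡ u
  out-of-a y e with edge⁻ e
  ... | inj₁ old               = ⊥-elim (a∉t (proj₁ (T-ends t a y old)))
  ... | inj₂ (inj₁ (_ , y≡u))  = y≡u
  ... | inj₂ (inj₂ (a≡u , _))  = ⊥-elim (a≢u a≡u)

  restrict : ∀ {x y} → a ≢ x → a ≢ y → T′ x y ≡ true → T t x y ≡ true
  restrict a≢x a≢y e with edge⁻ e
  ... | inj₁ old               = old
  ... | inj₂ (inj₁ (x≡a , _))  = ⊥-elim (a≢x (≡-sym x≡a))
  ... | inj₂ (inj₂ (_ , y≡a))  = ⊥-elim (a≢y (≡-sym y≡a))

  -- A cycle either passes the pendant vertex a (impossible) or is a cycle of t.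
  acyclic′ : ¬ Cycle T′
  acyclic′ c with Any.any? (a ≟_) (Cycle.verts c)
  ... | yes a∈c = pendant∉cycle into-a out-of-a c a∈c
  ... | no  a∉c = acyclic t (mapCycle id (λ _ _ → id) restrict c (¬Any⇒All¬ _ a∉c))

  old-walk : ∀ {x y} → Walk (T t) x y → Walk T′ x y
  old-walk = mapWalk id (λ _ _ e → edge⁺ (inj₁ e))

  to-u : ∀ x → x ∈ₛ V′ → Walk T′ x u
  to-u x x∈ with x∈p∪q⁻ (V t) ⁅ a ⁆ x∈
  ... | inj₁ x∈t = old-walk (connected t x u x∈t u∈t)
  ... | inj₂ x∈a rewrite x∈⁅y⁆⇒x≡y a x∈a = step (edge⁺ (inj₂ (inj₁ (refl , refl)))) here

  from-u : ∀ x → x ∈ₛ V′ → Walk T′ u x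
  from-u x x∈ with x∈p∪q⁻ (V t) ⁅ a ⁆ x∈
  ... | inj₁ x∈t = old-walk (connected t u x u∈t x∈t)
  ... | inj₂ x∈a rewrite x∈⁅y⁆⇒x≡y a x∈a = step (edge⁺ (inj₂ (inj₂ (refl , refl)))) here

  tree : Tree G
  tree = record
    { V         = V′
    ; T         = T′
    ; T-sym     = addEdge-sym (T-sym t) a u
    ; T⊆G       = λ x y e → in-G (edge⁻ e)
    ; T-ends    = λ x y e → ends (edge⁻ e)
    ; connected = λ x y x∈ y∈ → to-u x x∈ ++ʷ from-u y y∈
    ; acyclic   = acyclic′
    }
    where
    in-G : ∀ {x y} → T t x y ≡ true ⊎ IsPair a u x y → adj G x y ≡ true
    in-G {x} {y} (inj₁ old)      = T⊆G t x y old
    in-G (inj₂ (inj₁ (refl , refl))) = au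
    in-G (inj₂ (inj₂ (refl , refl))) = trans (Graph.sym G u a) au
    ends : ∀ {x y} → T t x y ≡ true ⊎ IsPair a u x y → x ∈ₛ V′ × y ∈ₛ V′
    ends {x} {y} (inj₁ old)      = x∈p∪q⁺ (inj₁ (proj₁ (T-ends t x y old))) , x∈p∪q⁺ (inj₁ (proj₂ (T-ends t x y old)))
    ends (inj₂ (inj₁ (refl , refl))) = a∈V′ , u∈V′
    ends (inj₂ (inj₂ (refl , refl))) = u∈V′ , a∈V′

  -- Adjacent edges of t + au differ in colour: two old edges by properness
  -- of t, an old and the new edge by freshness, and the new edge is never
  -- adjacent to itself in a path x y z with x ≢ z.
  proper : ∀ {m} (c : Coloring G m) → ProperTree c t → ProperTree (recolour c a u) tree
  proper c pr x y z xy yz x≢z with edge⁻ xy | edge⁻ yz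
  ... | inj₁ old₁ | inj₁ old₂ =
    recolour-distinct c (old-not-new x y old₁) (old-not-new y z old₂) (pr x y z old₁ old₂ x≢z)
  ... | inj₁ old₁ | inj₂ new₂ = recolour-new≢old c new₂ (old-not-new x y old₁) ∘ ≡-sym
  ... | inj₂ new₁ | inj₁ old₂ = recolour-new≢old c new₁ (old-not-new y z old₂)
  ... | inj₂ new₁ | inj₂ new₂ = ⊥-elim (x≢z (IsPair-shared a≢u new₁ new₂))

SpannedIn : ∀ {n m} {G : Graph n} → Coloring G m → Subset n → Subset n → Set
SpannedIn {G = G} c W S = Σ (Tree G) λ t → IsSTree S t × V t ⊆ W × ProperTree c t

ProperOn : ∀ {n} (G : Graph n) (k : ℕ) (W : Subset n) (m : ℕ) → Set
ProperOn {n} G k W m = Σ (Coloring G m) λ c → ∀ S → S ⊆ W → ∣ S ∣ ≤ k → SpannedIn c W S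

ProperOn-mono : ∀ {n} {G : Graph n} {k W m m′} → m ≤ m′ → ProperOn G k W m → ProperOn G k W m′
ProperOn-mono {G = G} {m′ = m′} m≤m′ (c , span) = widened , λ S S⊆W ∣S∣≤k →
  let (t , S⊆t , t⊆W , proper) = span S S⊆W ∣S∣≤k in
  t , S⊆t , t⊆W , λ x y z xy yz x≢z → proper x y z xy yz x≢z ∘ inject≤-injective m≤m′ m≤m′ _ _
  where
  widened : Coloring G m′
  widened = record { col = λ x y → inject≤ (col c x y) m≤m′
                   ; col-sym = λ x y → cong (λ i → inject≤ i m≤m′) (col-sym c x y) }

-- A set S ∌ a keeps its old tree;
-- a set S ∋ a is spanned by attaching a to a tree spanning (S ∩ W) ∪ {u}.
ProperOn-step : ∀ {n} {G : Graph n} {k W m} {a u : Fin n} →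
  a ∉ W → u ∈ₛ W → adj G a u ≡ true → ProperOn G k W m → ProperOn G k (W ∪ ⁅ a ⁆) (suc m)
ProperOn-step {n} {k = k} {W} {a = a} {u} a∉W u∈W au (c , span) = recolour c a u , span′
  where
  W′ : Subset n
  W′ = W ∪ ⁅ a ⁆

  -- Without a, S lies in W and its old tree stays proper after recolouring.
  keep : ∀ {S} → SpannedIn c W S → SpannedIn (recolour c a u) W′ S
  keep (t , S⊆t , t⊆W , proper) =
    t , S⊆t , p⊆p∪q ⁅ a ⁆ ∘ t⊆W , recolour-proper c t (edges-avoid t (a∉W ∘ t⊆W)) proper

  attach : ∀ {S} → S ⊆ W′ → SpannedIn c W ((S ∩ W) ∪ ⁅ u ⁆) → SpannedIn (recolour c a u) W′ S
  attach {S} S⊆W′ (t , S₀⊆t , t⊆W , t-proper) = tree , S⊆tree , tree⊆W′ , proper c t-proper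
    where
    open Attach t (a∉W ∘ t⊆W) (S₀⊆t u (x∈p∪q⁺ (inj₂ (x∈⁅x⁆ u)))) au using (tree; proper)
    S⊆tree : IsSTree S tree
    S⊆tree x x∈S with x ∈? W
    ... | yes x∈W = x∈p∪q⁺ (inj₁ (S₀⊆t x (x∈p∪q⁺ (inj₁ (x∈p∩q⁺ (x∈S , x∈W))))))
    ... | no  x∉W with x∈p∪q⁻ W ⁅ a ⁆ (S⊆W′ x∈S)
    ...   | inj₁ x∈W = ⊥-elim (x∉W x∈W)
    ...   | inj₂ x∈a = x∈p∪q⁺ (inj₂ x∈a)
    tree⊆W′ : V tree ⊆ W′
    tree⊆W′ x∈ with x∈p∪q⁻ (V t) ⁅ a ⁆ x∈
    ... | inj₁ x∈t = x∈p∪q⁺ (inj₁ (t⊆W x∈t))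
    ... | inj₂ x∈a = x∈p∪q⁺ (inj₂ x∈a)

  span′ : ∀ S → S ⊆ W′ → ∣ S ∣ ≤ k → SpannedIn (recolour c a u) W′ S
  span′ S S⊆W′ ∣S∣≤k with a ∈? S
  ... | no a∉S = keep (span S S⊆W ∣S∣≤k)
    where
    S⊆W : S ⊆ W
    S⊆W {x} x∈S with x∈p∪q⁻ W ⁅ a ⁆ (S⊆W′ x∈S)
    ... | inj₁ x∈W = x∈W
    ... | inj₂ x∈a = ⊥-elim (a∉S (subst (_∈ₛ S) (x∈⁅y⁆⇒x≡y a x∈a) x∈S))
  ... | yes a∈S = attach S⊆W′ (span S₀ S₀⊆W ∣S₀∣≤k)
    where
    S₀ : Subset n
    S₀ = (S ∩ W) ∪ ⁅ u ⁆
    S₀⊆W : S₀ ⊆ W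
    S₀⊆W {x} x∈S₀ with x∈p∪q⁻ (S ∩ W) ⁅ u ⁆ x∈S₀
    ... | inj₁ x∈S∩W = proj₂ (x∈p∩q⁻ S W x∈S∩W)
    ... | inj₂ x∈u   = subst (_∈ₛ W) (≡-sym (x∈⁅y⁆⇒x≡y u x∈u)) u∈W
    -- S ∩ W misses a ∈ S, so it is strictly smaller than S.
    ∣S₀∣≤k : ∣ S₀ ∣ ≤ k
    ∣S₀∣≤k = ℕ.≤-trans (∣p∪⁅x⁆∣≤ (S ∩ W) u)
      (ℕ.≤-trans (p⊂q⇒∣p∣<∣q∣ (p∩q⊆p S W , a , a∈S , a∉W ∘ proj₂ ∘ x∈p∩q⁻ S W)) ∣S∣≤k)

-- The next vertex is an end of an edge leaving W, found on a
-- walk from an outside vertex to w ∈ W.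
ProperOn-grow : ∀ {n} {G : Graph n} {k} → Connected G → ∀ d {W m} → n ≤ ∣ W ∣ + d →
  ∀ {w} → w ∈ₛ W → ProperOn G k W m → ProperOn G k ⊤ (m + d)
ProperOn-grow {n} {G} {k} conn d {W} {m} fits w∈W inv with ∣ W ∣ <? n
... | no ∣W∣≮n = subst (λ X → ProperOn G k X (m + d)) (∣p∣≡n⇒p≡⊤ full) (ProperOn-mono (ℕ.m≤m+n m d) inv)
  where
  full : ∣ W ∣ ≡ n
  full = ℕ.≤-antisym (∣p∣≤n W) (ℕ.≮⇒≥ ∣W∣≮n)
ProperOn-grow conn zero fits w∈W inv | yes ∣W∣<n =
  ⊥-elim (ℕ.<⇒≱ ∣W∣<n (subst (_ ≤_) (ℕ.+-identityʳ _) fits))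
ProperOn-grow {n} {G} {k} conn (suc d) {W} {m} fits {w} w∈W inv | yes ∣W∣<n
  with outside W ∣W∣<n
... | x , x∉W with crossing W (conn x w) x∉W w∈W
... | a , u , a∉W , u∈W , au =
  subst (ProperOn G k ⊤) (≡-sym (ℕ.+-suc m d))
    (ProperOn-grow conn d (subst (n ≤_) (∣p∪⁅x⁆∣+d W d a∉W) fits) (p⊆p∪q ⁅ a ⁆ w∈W)
      (ProperOn-step a∉W u∈W au inv))

SmallSetsSpanned : ∀ {n m} (H : Graph n) → ℕ → Coloring H m → Set
SmallSetsSpanned {n} H k c = ∀ (S : Subset n) → ∣ S ∣ ≤ k → Σ (Tree H) λ t → IsSTree S t × ProperTree c t

module Embedding {nH nG} {H : Graph nH} {G : Graph nG} (f : Fin nH → Fin nG)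
  (inj : Injective _≡_ _≡_ f) (hom : ∀ u v → adj H u v ≡ true → adj G (f u) (f v) ≡ true)
  (i₀ : Fin nH) where

  -- A left inverse of f (vertices outside the image go to i₀).
  r : Fin nG → Fin nH
  r x with any? (λ i → f i ≟ x)
  ... | yes (i , _) = i
  ... | no  _       = i₀

  r∘f : ∀ i → r (f i) ≡ i
  r∘f i with any? (λ j → f j ≟ f i)
  ... | yes (j , fj≡fi) = inj fj≡fi
  ... | no  none        = ⊥-elim (none (i , refl))

  InImage : Fin nG → Set
  InImage x = f (r x) ≡ x

  inImage? : Decidable InImage
  inImage? x = f (r x) ≟ x

  f-inImage : ∀ i → InImage (f i)
  f-inImage i = cong f (r∘f i)

  image : Subset nG
  image = subsetOf inImage?

  ∣image∣ : nH ≤ ∣ image ∣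
  ∣image∣ = ℕ.≤-trans (ℕ.≤-reflexive (≡-sym (∣⊤∣≡n nH)))
    (ℕ.≤-trans (p⊆q⇒∣p∣≤∣q∣ all-in) (∣preimage∣≤ f inj image))
    where
    all-in : ⊤ ⊆ preimage f image
    all-in {i} _ = subsetOf⁺ (λ j → f j ∈? image) (subsetOf⁺ inImage? (f-inImage i))

  r-injective : ∀ {x y} → InImage x → InImage y → r x ≡ r y → x ≡ y
  r-injective fx fy rx≡ry = trans (≡-sym fx) (trans (cong f rx≡ry) fy)

  pullback : ∀ {m} → Coloring H m → Coloring G m
  pullback c = record { col = λ x y → col c (r x) (r y) ; col-sym = λ x y → col-sym c (r x) (r y) }

  module ImageTree (t : Tree H) where

    VG : Subset nG
    VG = subsetOf (λ x → inImage? x ×-dec r x ∈? V t)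

    TG : EdgeRel nG
    TG x y = does ((inImage? x ×-dec inImage? y) ×-dec (T t (r x) (r y) ≟ᵇ true))

    edge⁻ : ∀ {x y} → TG x y ≡ true → (InImage x × InImage y) × T t (r x) (r y) ≡ true
    edge⁻ {x} {y} = witness ((inImage? x ×-dec inImage? y) ×-dec (T t (r x) (r y) ≟ᵇ true))

    edge⁺ : ∀ i j → T t i j ≡ true → TG (f i) (f j) ≡ true
    edge⁺ i j e = dec-true ((inImage? (f i) ×-dec inImage? (f j)) ×-dec (T t (r (f i)) (r (f j)) ≟ᵇ true))
      ((f-inImage i , f-inImage j) , subst₂ (λ i′ j′ → T t i′ j′ ≡ true) (≡-sym (r∘f i)) (≡-sym (r∘f j)) e)

    vertex⁻ : ∀ {x} → x ∈ₛ VG → InImage x × r x ∈ₛ V t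
    vertex⁻ = subsetOf⁻ (λ x → inImage? x ×-dec r x ∈? V t)

    vertex⁺ : ∀ {x} → InImage x → r x ∈ₛ V t → x ∈ₛ VG
    vertex⁺ fx rx∈t = subsetOf⁺ (λ x → inImage? x ×-dec r x ∈? V t) (fx , rx∈t)

    TG-sym : ∀ x y → TG x y ≡ TG y x
    TG-sym x y = does-⇔ (mk⇔ swap swap)
      ((inImage? x ×-dec inImage? y) ×-dec (T t (r x) (r y) ≟ᵇ true))
      ((inImage? y ×-dec inImage? x) ×-dec (T t (r y) (r x) ≟ᵇ true))
      where
      swap : ∀ {x y} → (InImage x × InImage y) × T t (r x) (r y) ≡ true →
                       (InImage y × InImage x) × T t (r y) (r x) ≡ true
      swap {x} {y} ((fx , fy) , e) = (fy , fx) , trans (T-sym t (r y) (r x)) e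

    -- r carries a cycle of f(t) back to a cycle of t.
    acyclicG : ¬ Cycle TG
    acyclicG c = acyclic t (mapCycle r r-injective (λ _ _ e → proj₂ (edge⁻ e)) c
      (chain-ends (λ x y e → proj₁ (edge⁻ e)) chain (ℕ.≤-trans (s≤s (s≤s z≤n)) len≥3)))
      where open Cycle c

    tree : Tree G
    tree = record
      { V         = VG
      ; T         = TG
      ; T-sym     = TG-sym
      ; T⊆G       = λ x y e → let ((fx , fy) , e′) = edge⁻ e in
                      subst₂ (λ x′ y′ → adj G x′ y′ ≡ true) fx fy (hom _ _ (T⊆G t _ _ e′))
      ; T-ends    = λ x y e → let ((fx , fy) , e′) = edge⁻ e in
                      vertex⁺ fx (proj₁ (T-ends t _ _ e′)) , vertex⁺ fy (proj₂ (T-ends t _ _ e′))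
      ; connected = λ x y x∈ y∈ → let (fx , rx∈t) = vertex⁻ x∈ ; (fy , ry∈t) = vertex⁻ y∈ in
                      subst₂ (Walk TG) fx fy (mapWalk f edge⁺ (connected t (r x) (r y) rx∈t ry∈t))
      ; acyclic   = acyclicG
      }

    proper : ∀ {m} (c : Coloring H m) → ProperTree c t → ProperTree (pullback c) tree
    proper c pr x y z xy yz x≢z =
      let ((fx , fy) , e₁) = edge⁻ xy ; ((_ , fz) , e₂) = edge⁻ yz in
      pr (r x) (r y) (r z) e₁ e₂ (x≢z ∘ r-injective fx fz)

  image-spans : ∀ {m} (c : Coloring H m) {S} → S ⊆ image →
    (Σ (Tree H) λ t → IsSTree (preimage f S) t × ProperTree c t) → SpannedIn (pullback c) image S
  image-spans c {S} S⊆im (t , f⁻¹S⊆t , t-proper) = tree , S⊆tree , tree⊆im , proper c t-proper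
    where
    open ImageTree t
    S⊆tree : IsSTree S tree
    S⊆tree x x∈S =
      vertex⁺ fx (f⁻¹S⊆t (r x) (subsetOf⁺ (λ i → f i ∈? S) (subst (_∈ₛ S) (≡-sym fx) x∈S)))
      where
      fx : InImage x
      fx = subsetOf⁻ inImage? (S⊆im x∈S)
    tree⊆im : VG ⊆ image
    tree⊆im x∈ = subsetOf⁺ inImage? (proj₁ (vertex⁻ x∈))

  -- Base case: the pullback of a colouring spanning all small sets of H
  -- spans every set of at most k vertices of the image inside the image
  -- (its preimage is no larger, as f is injective).
  ProperOn-image : ∀ {k m} (c : Coloring H m) → SmallSetsSpanned H k c → ProperOn G k image m
  ProperOn-image c spanned = pullback c , λ S S⊆im ∣S∣≤k →
    image-spans c S⊆im (spanned (preimage f S) (ℕ.≤-trans (∣preimage∣≤ f inj S) ∣S∣≤k))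

extend-to-G : ∀ {nG nH m k} {G : Graph nG} {H : Graph nH} → Connected G → Subgraph H G →
  Fin nH → (c : Coloring H m) → SmallSetsSpanned H k c → HasKProperColoring G k (m + (nG ∸ nH))
extend-to-G {nG} {nH} {G = G} {H} conG (f , inj , hom) i₀ c spanned with
  ProperOn-grow conG (nG ∸ nH) fits (subsetOf⁺ inImage? (f-inImage i₀)) (ProperOn-image c spanned)
  where
  open Embedding {H = H} {G} f inj hom i₀
  fits : nG ≤ ∣ image ∣ + (nG ∸ nH)
  fits = ℕ.≤-trans (ℕ.m≤n+m∸n nG nH) (ℕ.+-monoˡ-≤ (nG ∸ nH) ∣image∣)
... | c′ , span = c′ , λ S ∣S∣≡k →
  let (t , S⊆t , _ , proper) = span S (λ _ → ∈⊤) (ℕ.≤-reflexive ∣S∣≡k) in t , S⊆t , proper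

-- For k ≤ n, a k-proper colouring spans every set of at most k vertices:
-- enlarge the set to exactly k vertices first.
kProper⇒small : ∀ {n m k} {H : Graph n} {c : Coloring H m} → k ≤ n → KProper H k c →
  SmallSetsSpanned H k c
kProper⇒small {n} {k = k} k≤n kp S ∣S∣≤k
  with enlarge (k ∸ ∣ S ∣) S (subst (_≤ n) (≡-sym (ℕ.m+[n∸m]≡n ∣S∣≤k)) k≤n)
... | S′ , S⊆S′ , size with kp S′ (trans size (ℕ.m+[n∸m]≡n ∣S∣≤k))
... | t , S′⊆t , proper = t , (λ x → S′⊆t x ∘ S⊆S′) , proper

-- An n-proper colouring of a graph of order n spans every vertex set,
-- since the tree spanning all of V(H) does.
spanning⇒small : ∀ {n m k} {H : Graph n} {c : Coloring H m} → KProper H n c →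
  SmallSetsSpanned H k c
spanning⇒small {n} kp S _ with kp ⊤ (∣⊤∣≡n n)
... | t , V⊆t , proper = t , (λ x _ → V⊆t x ∈⊤) , proper

lemma2p5 : ∀ {nG nH : ℕ} (G : Graph nG) (H : Graph nH) →
    Connected G → Connected H → Subgraph H G → 2 ≤ nH →
    (∀ (k : ℕ) → 3 ≤ k → k ≤ nH → ∀ (pG pH : ℕ) →
      IsPx G k pG → IsPx H k pH → pG ≤ pH + (nG ∸ nH)) ×
    (∀ (k : ℕ) → nH ≤ k → k ≤ nG → 3 ≤ k → ∀ (pG pH : ℕ) →
      IsPx G k pG → IsPx H nH pH → pG ≤ pH + (nG ∸ nH))
lemma2p5 {nG} {nH} G H conG _ H⊆G (s≤s _) = first , second
  where
  first : ∀ k → 3 ≤ k → k ≤ nH → ∀ pG pH → IsPx G k pG → IsPx H k pH → pG ≤ pH + (nG ∸ nH)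
  first k _ k≤nH pG pH (_ , minimal) ((c , kp) , _) =
    minimal _ (extend-to-G conG H⊆G zero c (kProper⇒small {H = H} {c} k≤nH kp))
  second : ∀ k → nH ≤ k → k ≤ nG → 3 ≤ k → ∀ pG pH →
    IsPx G k pG → IsPx H nH pH → pG ≤ pH + (nG ∸ nH)
  second k _ _ _ pG pH (_ , minimal) ((c , kp) , _) =
    minimal _ (extend-to-G conG H⊆G zero c (spanning⇒small {H = H} {c} kp))
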